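{- In the chain graph of $\sigma\in S_n$ for disjoint $k$-sets $A,B$ with $\sigma_{\langle A\rangle}=\sigma_{\langle B\rangle}$, an edge of a chain cannot be cut by a fixed point.
   Context: $S_n$ is the set of permutations of $[n]$. Points of $\sigma$ are $(i,\sigma(i))$, identified with positions $i$ and ordered left to right. For $A\subset[n]$, $\sigma_{\langle A\rangle}$ is the permutation in the same relative order as the word obtained by deleting the entries at positions in $A$; if $[n]\setminus A=\{i_1<\dots<i_r\}$, the $i_j$th entry of $\sigma$ fulfills the $j$th entry of $\sigma_{\langle A\rangle}$. For disjoint $k$-sets $A,B$ with $\sigma_{\langle A\rangle}=\sigma_{\langle B\rangle}$, the chain graph has vertex set the points of $\sigma$; for each $i\in[n-k]$ an edge joins the point fulfilling the $i$th entry of $\sigma_{\langle A\rangle}$ and the point fulfilling the $i$th entry of $\sigma_{\langle B\rangle}$ when these differ; when they coincide, that point is called a fixed point and no edge is added. The chains are the connected components of the chain graph having at least one edge. For distinct points $p,p'$, a point $q$ cuts $pp'$ if $q$'s position lies strictly between the positions of $p,p'$ or $q$'s value lies strictly between $\sigma(p),\sigma(p')$. -}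

module Defs where

open import Data.Nat using (ℕ; _<_)
open import Data.Nat.Properties using (_<?_)
open import Data.Fin using (Fin; toℕ)
open import Data.Fin.Subset using (Subset; _∈_; _∉_; ∣_∣)
open import Data.Fin.Subset.Properties using (_∈?_)
open import Data.Fin.Permutation using (Permutation′; _⟨$⟩ʳ_)
open import Data.List using (List; allFin; filter; map; length; zip)
open import Data.List.Membership.Propositional using () renaming (_∈_ to _∈ₗ_)
open import Data.Product using (_×_; _,_; ∃)
open import Data.Sum using (_⊎_)
open import Relation.Binary.PropositionalEquality using (_≡_; _≢_)
open import Relation.Nullary using (¬_)
open import Relation.Nullary.Decidable using (¬?)

-- Positions are Fin n (0-based), ordered by toℕ.
allPos : (n : ℕ) → List (Fin n)
allPos n = allFin n

kept : {n : ℕ} → Subset n → List (Fin n)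
kept A = filter (λ i → ¬? (i ∈? A)) (allPos _)

-- Standardization of a word with distinct entries: each entry is replaced
-- by its rank (number of entries of the word smaller than it), giving the
-- permutation (0-based) in the same relative order.
rank : {n : ℕ} → List (Fin n) → Fin n → ℕ
rank w x = length (filter (λ y → toℕ y <? toℕ x) w)

std : {n : ℕ} → List (Fin n) → List ℕ
std w = map (rank w) w

-- σ_⟨A⟩ : the permutation in the same relative order as σ with the entries
-- at positions in A deleted.
delete : {n : ℕ} → Permutation′ n → Subset n → List ℕ
delete σ A = std (map (σ ⟨$⟩ʳ_) (kept A))

Disjoint : {n : ℕ} → Subset n → Subset n → Set
Disjoint A B = ∀ i → i ∈ A → i ∉ B

-- The i-th entry of σ_⟨A⟩ is fulfilled by the i-th element of kept A.
-- Pairs (p , q) : p fulfils the i-th entry of σ_⟨A⟩, q that of σ_⟨B⟩.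
fulfilPairs : {n : ℕ} → Subset n → Subset n → List (Fin n × Fin n)
fulfilPairs A B = zip (kept A) (kept B)

-- Edges of the chain graph (the edges of the chains are exactly these).
ChainEdge : {n : ℕ} → Subset n → Subset n → Fin n → Fin n → Set
ChainEdge A B p p' = (p , p') ∈ₗ fulfilPairs A B × p ≢ p'

FixedPoint : {n : ℕ} → Subset n → Subset n → Fin n → Set
FixedPoint A B q = (q , q) ∈ₗ fulfilPairs A B

StrictlyBetween : ℕ → ℕ → ℕ → Set
StrictlyBetween x a b = (a < x × x < b) ⊎ (b < x × x < a)

Cuts : {n : ℕ} → Permutation′ n → Fin n → Fin n → Fin n → Set
Cuts σ q p p' =
  StrictlyBetween (toℕ q) (toℕ p) (toℕ p')
  ⊎ StrictlyBetween (toℕ (σ ⟨$⟩ʳ q)) (toℕ (σ ⟨$⟩ʳ p)) (toℕ (σ ⟨$⟩ʳ p'))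

module Submission where

-- Call a relation R between points order-matching for a key
-- (a numerical coordinate) if whenever R a b and R c d, key a < key c
-- forces key b < key d.  Such a relation cannot relate q to itself while
-- q lies strictly between p and p' with R p p' (lemma no-cut).
--
-- The fulfilment relation "p fulfils the i-th entry of σ_⟨A⟩ and p' the
-- i-th entry of σ_⟨B⟩" (membership in fulfilPairs A B) relates the ends of
-- every chain edge and relates every fixed point to itself, and it is
-- order-matching for both coordinates of a point:
--   * positions: kept A and kept B are increasing lists, zipped index by
--     index (position-matching);
--   * values: σ_⟨A⟩ = σ_⟨B⟩ says matched entries have the same rank in the
--     two words, and rank is strictly monotone and order-reflecting
--     (value-matching, via std-matching and the rank lemmas).
-- The corollary applies no-cut to whichever coordinate a cut would use.

open import Defs
open import Data.Nat using (ℕ; suc; _<_; _≤_; s<s)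
open import Data.Nat.Properties
  using (_<?_; <-irrefl; <-asym; <-trans; <-≤-trans; ≤-refl; <⇒≤; ≤⇒≯; ≮⇒≥; n<1+n; module ≤-Reasoning)
open import Data.Fin using (Fin; toℕ)
open import Data.Fin.Subset using (Subset; ∣_∣)
open import Data.Fin.Permutation using (Permutation′; _⟨$⟩ʳ_)
open import Data.List using (List; _∷_; zip; map; length)
import Data.List.Properties as List
open import Data.List.Relation.Unary.Any using (here; there)
import Data.List.Relation.Unary.All as All
open import Data.List.Relation.Unary.AllPairs using (AllPairs; _∷_)
import Data.List.Relation.Unary.AllPairs.Properties as AllPairs
open import Data.List.Membership.Propositional using () renaming (_∈_ to _∈ₗ_)
open import Data.List.Relation.Binary.Sublist.Propositional using (_⊆_; ⊆-refl; _∷ʳ_)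
open import Data.List.Relation.Binary.Sublist.Propositional.Properties
  using (filter⁺; length-mono-≤)
open import Data.Product using (_,_)
open import Data.Sum using (inj₁; inj₂)
open import Relation.Binary.PropositionalEquality using (_≡_; refl; sym; cong; subst)
open import Relation.Nullary using (¬_; yes; no; contradiction)

record OrderMatching {X : Set} (key : X → ℕ) (R : X → X → Set) : Set where
  constructor order-matching
  field
    matched-order : ∀ {a b c d} → R a b → R c d → key a < key c → key b < key d

open OrderMatching

no-cut : {X : Set} {key : X → ℕ} {R : X → X → Set} → OrderMatching key R →
  ∀ {p p' q} → R p p' → R q q → ¬ StrictlyBetween (key q) (key p) (key p')
no-cut matching pp' qq (inj₁ (p<q , q<p')) = <-asym q<p' (matched-order matching pp' qq p<q)
no-cut matching pp' qq (inj₂ (p'<q , q<p)) = <-asym p'<q (matched-order matching qq pp' q<p)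

zip-∈ˡ : {X Y : Set} {xs : List X} {ys : List Y} {x : X} {y : Y} →
  (x , y) ∈ₗ zip xs ys → x ∈ₗ xs
zip-∈ˡ {xs = _ ∷ _} {_ ∷ _} (here refl) = here refl
zip-∈ˡ {xs = _ ∷ _} {_ ∷ _} (there m)   = there (zip-∈ˡ m)

zip-∈ʳ : {X Y : Set} {xs : List X} {ys : List Y} {x : X} {y : Y} →
  (x , y) ∈ₗ zip xs ys → y ∈ₗ ys
zip-∈ʳ {xs = _ ∷ _} {_ ∷ _} (here refl) = here refl
zip-∈ʳ {xs = _ ∷ _} {_ ∷ _} (there m)   = there (zip-∈ʳ m)

zip-map : {X Y U V : Set} (f : X → U) (g : Y → V) {xs : List X} {ys : List Y}
  {x : X} {y : Y} → (x , y) ∈ₗ zip xs ys → (f x , g y) ∈ₗ zip (map f xs) (map g ys)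
zip-map f g {_ ∷ _} {_ ∷ _} (here refl) = here refl
zip-map f g {_ ∷ _} {_ ∷ _} (there m)   = there (zip-map f g m)

zip-diagonal : {X : Set} {xs : List X} {x y : X} → (x , y) ∈ₗ zip xs xs → x ≡ y
zip-diagonal {xs = _ ∷ _} (here refl) = refl
zip-diagonal {xs = _ ∷ _} (there m)   = zip-diagonal m

Increasing : {X : Set} → (X → ℕ) → List X → Set
Increasing key = AllPairs (λ a b → key a < key b)

zip-increasing-monotone : {X : Set} {key : X → ℕ} {xs ys : List X} →
  Increasing key xs → Increasing key ys → ∀ {a b c d} →
  (a , b) ∈ₗ zip xs ys → (c , d) ∈ₗ zip xs ys → key a < key c → key b < key d
zip-increasing-monotone {xs = _ ∷ _} {_ ∷ _} _ _ (here refl) (here refl) x<x =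
  contradiction x<x (<-irrefl refl)
zip-increasing-monotone {xs = _ ∷ _} {_ ∷ _} _ (y<ys ∷ _) (here refl) (there cd) _ =
  All.lookup y<ys (zip-∈ʳ cd)
zip-increasing-monotone {xs = _ ∷ _} {_ ∷ _} (x<xs ∷ _) _ (there ab) (here refl) a<x =
  contradiction (All.lookup x<xs (zip-∈ˡ ab)) (<-asym a<x)
zip-increasing-monotone {xs = _ ∷ _} {_ ∷ _} (_ ∷ inc-xs) (_ ∷ inc-ys) (there ab) (there cd) =
  zip-increasing-monotone inc-xs inc-ys ab cd

kept-increasing : {n : ℕ} (A : Subset n) → Increasing toℕ (kept A)
kept-increasing A = AllPairs.filter⁺ _ (AllPairs.tabulate⁺-< (λ i<j → i<j))

module _ {n : ℕ} where

  rank-accept : ∀ {z x : Fin n} (w : List (Fin n)) →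
    toℕ z < toℕ x → rank (z ∷ w) x ≡ suc (rank w x)
  rank-accept {x = x} w z<x = cong length (List.filter-accept (λ y → toℕ y <? toℕ x) z<x)

  rank-reject : ∀ {z x : Fin n} (w : List (Fin n)) →
    ¬ toℕ z < toℕ x → rank (z ∷ w) x ≡ rank w x
  rank-reject {x = x} w z≮x = cong length (List.filter-reject (λ y → toℕ y <? toℕ x) z≮x)

  rank-mono : ∀ (u v : List (Fin n)) (x y : Fin n) →
    u ⊆ v → toℕ x ≤ toℕ y → rank u x ≤ rank v y
  rank-mono u v x y u⊆v x≤y = length-mono-≤
    (filter⁺ (λ z → toℕ z <? toℕ x) (λ z → toℕ z <? toℕ y)
             (λ { refl z<x → <-≤-trans z<x x≤y }) u⊆v)

  -- Strictness on entries of the word: x itself is counted for y but not x.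
  rank-strict : ∀ {w : List (Fin n)} {x y : Fin n} →
    x ∈ₗ w → toℕ x < toℕ y → rank w x < rank w y
  rank-strict {x ∷ w} {x} {y} (here refl) x<y = begin-strict
    rank (x ∷ w) x  ≡⟨ rank-reject w (<-irrefl refl) ⟩
    rank w x        ≤⟨ rank-mono w w x y ⊆-refl (<⇒≤ x<y) ⟩
    rank w y        <⟨ n<1+n _ ⟩
    suc (rank w y)  ≡⟨ sym (rank-accept w x<y) ⟩
    rank (x ∷ w) y  ∎
    where open ≤-Reasoning
  rank-strict {z ∷ w} {x} {y} (there x∈w) x<y with toℕ z <? toℕ x
  ... | yes z<x = begin-strict
    rank (z ∷ w) x  ≡⟨ rank-accept w z<x ⟩
    suc (rank w x)  <⟨ s<s (rank-strict x∈w x<y) ⟩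
    suc (rank w y)  ≡⟨ sym (rank-accept w (<-trans z<x x<y)) ⟩
    rank (z ∷ w) y  ∎
    where open ≤-Reasoning
  ... | no z≮x = begin-strict
    rank (z ∷ w) x  ≡⟨ rank-reject w z≮x ⟩
    rank w x        <⟨ rank-strict x∈w x<y ⟩
    rank w y        ≤⟨ rank-mono w (z ∷ w) y y (z ∷ʳ ⊆-refl) ≤-refl ⟩
    rank (z ∷ w) y  ∎
    where open ≤-Reasoning

  rank-reflects : ∀ (w : List (Fin n)) (x y : Fin n) →
    rank w x < rank w y → toℕ x < toℕ y
  rank-reflects w x y rx<ry with toℕ x <? toℕ y
  ... | yes x<y = x<y
  ... | no x≮y  = contradiction rx<ry (≤⇒≯ (rank-mono w w y x ⊆-refl (≮⇒≥ x≮y)))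

  std-rank : ∀ {u v : List (Fin n)} {x y : Fin n} →
    std u ≡ std v → (x , y) ∈ₗ zip u v → rank u x ≡ rank v y
  std-rank {u} {v} {x} {y} u≈v xy = zip-diagonal
    (subst (λ t → (rank u x , rank v y) ∈ₗ zip (std u) t) (sym u≈v) (zip-map (rank u) (rank v) xy))

  std-matching : ∀ {u v : List (Fin n)} → std u ≡ std v →
    OrderMatching toℕ (λ x y → (x , y) ∈ₗ zip u v)
  std-matching {u} {v} u≈v = order-matching λ {a} {b} {c} {d} ab cd a<c →
    rank-reflects v b d (begin-strict
      rank v b  ≡⟨ sym (std-rank u≈v ab) ⟩
      rank u a  <⟨ rank-strict (zip-∈ˡ ab) a<c ⟩
      rank u c  ≡⟨ std-rank u≈v cd ⟩
      rank v d  ∎)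
    where open ≤-Reasoning

position-matching : {n : ℕ} (A B : Subset n) →
  OrderMatching toℕ (λ a b → (a , b) ∈ₗ fulfilPairs A B)
position-matching A B =
  order-matching (zip-increasing-monotone (kept-increasing A) (kept-increasing B))

value-matching : {n : ℕ} (σ : Permutation′ n) (A B : Subset n) →
  delete σ A ≡ delete σ B →
  OrderMatching (λ i → toℕ (σ ⟨$⟩ʳ i)) (λ a b → (a , b) ∈ₗ fulfilPairs A B)
value-matching {n} σ A B σA≡σB = order-matching λ ab cd →
  matched-order (std-matching σA≡σB) (zip-map σ′ σ′ ab) (zip-map σ′ σ′ cd)
  where
  σ′ : Fin n → Fin n
  σ′ i = σ ⟨$⟩ʳ i

corollary2p14 : (n k : ℕ) (σ : Permutation′ n) (A B : Subset n) →
    Disjoint A B → ∣ A ∣ ≡ k → ∣ B ∣ ≡ k → delete σ A ≡ delete σ B →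
    (p p' q : Fin n) → ChainEdge A B p p' → FixedPoint A B q →
    ¬ Cuts σ q p p'
corollary2p14 _ _ σ A B _ _ _ σA≡σB _ _ _ (pp' , _) qq (inj₁ position-cut) =
  no-cut (position-matching A B) pp' qq position-cut
corollary2p14 _ _ σ A B _ _ _ σA≡σB _ _ _ (pp' , _) qq (inj₂ value-cut) =
  no-cut (value-matching σ A B σA≡σB) pp' qq value-cut
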